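{- Let $G$ be a finite simple $r$-regular graph, where $r \geq 3$ is odd, and let $k \geq 5$ be an integer. Then $G$ is completely $k$-magic.
   Context: For $k\ge 2$, $\mathbb{Z}_k$ is the integers modulo $k$. For $c \in \mathbb{Z}_k$, a graph $G$ is $c$-sum $k$-magic if there is an edge labeling $\ell: E(G) \to \mathbb{Z}_k\setminus\{0\}$ such that for every vertex $v$, $\sum_{u \in N(v)} \ell(uv) \equiv c \pmod k$, where $N(v)$ is the neighborhood of $v$. $G$ is completely $k$-magic if it is $c$-sum $k$-magic for every $c \in \mathbb{Z}_k$. -}

module Defs where

open import Data.Nat using (ℕ; zero; suc; _+_; _%_; _≥_; NonZero)
open import Data.Nat.Properties using ()
open import Data.Bool using (Bool; true; false; if_then_else_)
open import Data.Fin using (Fin; toℕ)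
open import Data.Fin.Subset using ()
open import Data.Vec.Functional using (Vector; foldr)
open import Data.Empty using (⊥)
open import Relation.Binary.PropositionalEquality using (_≡_; _≢_)
open import Data.Product using (Σ; _×_)

Odd : ℕ → Set
Odd r = r % 2 ≡ 1

record SimpleGraph (n : ℕ) : Set where
  field
    adj       : Fin n → Fin n → Bool
    symmetric : ∀ u v → adj u v ≡ adj v u
    loopless  : ∀ v → adj v v ≡ false

open SimpleGraph public

Σ[_] : ∀ {n} → (Fin n → ℕ) → ℕ
Σ[_] {n} f = foldr _+_ 0 f

degree : ∀ {n} → SimpleGraph n → Fin n → ℕ
degree G v = Σ[ (λ u → if adj G v u then 1 else 0) ]

Regular : ∀ {n} → ℕ → SimpleGraph n → Set
Regular r G = ∀ v → degree G v ≡ r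

-- An edge labeling with values in Z_k \ {0}: a function on ordered pairs that
-- is symmetric (so it is a function of the edge uv) and nonzero on every edge.
-- Its values on non-edges are irrelevant.
record EdgeLabeling {n : ℕ} (k : ℕ) (G : SimpleGraph n) : Set where
  field
    label     : Fin n → Fin n → Fin k
    label-sym : ∀ u v → adj G u v ≡ true → label u v ≡ label v u
    nonzero   : ∀ u v → adj G u v ≡ true → toℕ (label u v) ≢ 0

open EdgeLabeling public

vertexSum : ∀ {n k} {G : SimpleGraph n} → EdgeLabeling k G → Fin n → ℕ
vertexSum {G = G} ℓ v = Σ[ (λ u → if adj G v u then toℕ (label ℓ v u) else 0) ]

SumMagic : ∀ {n} (k : ℕ) .{{_ : NonZero k}} → Fin k → SimpleGraph n → Set
SumMagic k c G = Σ (EdgeLabeling k G) λ ℓ → ∀ v → vertexSum ℓ v % k ≡ toℕ c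

CompletelyMagic : ∀ {n} (k : ℕ) .{{_ : NonZero k}} → SimpleGraph n → Set
CompletelyMagic k G = ∀ (c : Fin k) → SumMagic k c G

-- An r-regular graph contains m edge-disjoint permutations σ₁, …, σₘ of its vertices with
-- v ~ σᵢ(v) for every m ≤ r: the bipartite double cover is r-regular, so by Hall's theorem it
-- has a perfect matching, whose removal leaves an (r−1)-regular one.  Let F be the union of
-- these permutations, viewed as an m-regular directed subgraph, and label an edge uv by
-- t + j·w, where j ∈ {0, 1, 2} counts the arcs of F between u and v.  Every vertex then has
-- label sum r·t + 2m·w, so it suffices to find m ≤ 3 and t, w modulo k with t, t + w, t + 2w
-- nonzero and r·t + 2m·w ≡ c.  With m = 1 this means halving c − r·t: for odd k this works
-- for one of t = 1, −1, 2 unless c ≡ 0 and k divides r − 1 or r − 2; for even k it works for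
-- t = 1, 2 or 4 (of the parity of c, as r is odd) unless c ≡ 0 and k divides 4(r − 1).  The
-- exceptional cases are settled by m = 2, t = −4, w = 1 and m = 3, t = −3, w = 1, using k ≥ 5.
module Submission where

open import Defs
open import Data.Bool.Base using (Bool; true; false; T; not; _∧_; _∨_; if_then_else_)
open import Data.Bool.Properties using (T-∧; T-∨)
open import Data.Empty using (⊥-elim)
open import Data.Fin.Base using (Fin; zero; suc; toℕ; punchOut)
open import Data.Fin.Properties
  using (_≟_; any?; all?; pigeonhole; punchOut-injective; toℕ-fromℕ<; toℕ-injective; toℕ<n)
  renaming (<-irrefl to <ᶠ-irrefl)
open import Data.Fin.Subset.Properties using (anySubset?)
open import Data.Nat.Base using (ℕ; zero; suc; z≤n; s≤s; NonZero; >-nonZero)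
open import Data.Product using (∃; _×_; _,_; proj₁; proj₂)
open import Data.Sum using (_⊎_; inj₁; inj₂; [_,_]′)
open import Data.Unit using (tt)
open import Data.Vec.Base using (lookup; tabulate)
open import Data.Vec.Properties using (lookup∘tabulate)
open import Function.Base using (_∘_; _$_)
open import Function.Bundles using (Equivalence; mk⇔)
open import Relation.Nullary using (¬_; Dec; does; yes; no; ⌊_⌋; _×-dec_; _→-dec_)
open import Relation.Nullary.Decidable using (T?; toWitness; fromWitness; does-⇔; ⌊⌋-map′; isYes≗does)
open import Relation.Binary.PropositionalEquality

module Arithmetic where

  open import Data.Integer.Base using (ℤ; +_; -_; _+_; _-_; _*_; ∣_∣; _⊖_; 0ℤ; 1ℤ)
  open import Data.Integer.Properties using (pos-+; pos-*; +-identityˡ; ∣⊖∣-<; [+m]-[+n]≡m⊖n)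
  open import Data.Integer.DivMod using (_%ℕ_; _/ℕ_; a≡a%ℕn+[a/ℕn]*n)
  open import Data.Integer.Divisibility.Signed
    using (_∣_; _∣?_; divides; ∣-refl; ∣-trans; ∣ᵤ⇒∣; ∣⇒∣ᵤ;
           ∣m∣n⇒∣m+n; ∣m∣n⇒∣m-n; ∣n⇒∣m*n; ∣m⇒∣m*n; ∣m⇒∣-m)
  open import Data.Integer.Tactic.RingSolver using (solve-∀)
  import Data.Nat.Base as ℕ
  import Data.Nat.Properties as ℕ
  open import Data.Nat.Divisibility using (>⇒∤; ∣1⇒≡1; m%n≡0⇒n∣m)
  open import Data.Nat.DivMod using (_mod_; m≡m%n+[m/n]*n; m%n<n; m/n<m; m≥n⇒m/n>0)
  open import Relation.Binary.Definitions using (tri<; tri≈; tri>)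
  open import Relation.Nullary.Decidable using (True)
  import Data.Sum as Sum

  ∤-small : ∀ {k} x → 0 ℕ.< ∣ x ∣ → ∣ x ∣ ℕ.< k → ¬ + k ∣ x
  ∤-small x 0<∣x∣ ∣x∣<k k∣x = >⇒∤ {{ℕ.>-nonZero 0<∣x∣}} ∣x∣<k (∣⇒∣ᵤ k∣x)

  record Weights (k : ℕ) (R C : ℤ) : Set where
    field
      m       : ℕ
      m≤3     : m ℕ.≤ 3
      t w     : ℤ
      k∤t     : ¬ + k ∣ t
      k∤t+w   : ¬ + k ∣ t + w
      k∤t+2w  : ¬ + k ∣ t + w + w
      k∣sum-c : + k ∣ t * R + w * + (m ℕ.+ m) - C

  module _ {k : ℕ} (k≥5 : 5 ℕ.≤ k) where

    private
      K : ℤ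
      K = + k

    k∤±≤4 : ∀ x {0<∣x∣ : True (0 ℕ.<? ∣ x ∣)} {∣x∣≤4 : True (∣ x ∣ ℕ.≤? 4)} → ¬ K ∣ x
    k∤±≤4 x {0<∣x∣} {∣x∣≤4} = ∤-small x (toWitness 0<∣x∣) (ℕ.<-≤-trans (s≤s (toWitness ∣x∣≤4)) k≥5)

    twoPermutations : ∀ {R C} → K ∣ C → K ∣ + 4 * (R - 1ℤ) → Weights k R C
    twoPermutations {R} {C} k∣C k∣4[R-1] = record
      { m = 2 ; m≤3 = s≤s (s≤s z≤n) ; t = - + 4 ; w = 1ℤ
      ; k∤t = k∤±≤4 (- + 4) ; k∤t+w = k∤±≤4 (- + 3) ; k∤t+2w = k∤±≤4 (- + 2)
      ; k∣sum-c = subst (K ∣_) (identity R C) (∣m⇒∣-m (∣m∣n⇒∣m+n k∣4[R-1] k∣C))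
      }
      where
      identity : ∀ R C → - (+ 4 * (R - 1ℤ) + C) ≡ - + 4 * R + 1ℤ * + 4 - C
      identity = solve-∀

    threePermutations : ∀ {R C} → K ∣ C → K ∣ + 3 * (R - + 2) → Weights k R C
    threePermutations {R} {C} k∣C k∣3[R-2] = record
      { m = 3 ; m≤3 = s≤s (s≤s (s≤s z≤n)) ; t = - + 3 ; w = 1ℤ
      ; k∤t = k∤±≤4 (- + 3) ; k∤t+w = k∤±≤4 (- + 2) ; k∤t+2w = k∤±≤4 (- + 1)
      ; k∣sum-c = subst (K ∣_) (identity R C) (∣m⇒∣-m (∣m∣n⇒∣m+n k∣3[R-2] k∣C))
      }
      where
      identity : ∀ R C → - (+ 3 * (R - + 2) + C) ≡ - + 3 * R + 1ℤ * + 6 - C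
      identity = solve-∀

    -- As K ∣ 2h + 1, 1 + h is an inverse of 2 modulo K, so w = (1 + h)(C − R t) solves 2w ≡ C − R t.
    oddModulus : ∀ {R C} h → K ∣ 1ℤ + (h + h) → ∀ t → ¬ K ∣ t →
                 ¬ K ∣ C - (R - 1ℤ) * t → ¬ K ∣ C - (R - + 2) * t → Weights k R C
    oddModulus {R} {C} h k∣2h+1 t k∤t k∤A k∤B = record
      { m = 1 ; m≤3 = s≤s z≤n ; t = t ; w = (1ℤ + h) * D ; k∤t = k∤t
      ; k∤t+w   = λ k∣t+w →
          k∤B (subst (K ∣_) (twice-t+w t h R C) (∣m∣n⇒∣m-n (∣n⇒∣m*n (+ 2) k∣t+w) k∣D[2h+1]))
      ; k∤t+2w  = λ k∣t+2w → k∤A (subst (K ∣_) (t+2w t h R C) (∣m∣n⇒∣m-n k∣t+2w k∣D[2h+1]))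
      ; k∣sum-c = subst (K ∣_) (sum-c t h R C) k∣D[2h+1]
      }
      where
      D : ℤ
      D = C - R * t
      k∣D[2h+1] : K ∣ D * (1ℤ + (h + h))
      k∣D[2h+1] = ∣n⇒∣m*n D k∣2h+1
      twice-t+w : ∀ t h R C → + 2 * (t + (1ℤ + h) * (C - R * t)) - (C - R * t) * (1ℤ + (h + h))
                              ≡ C - (R - + 2) * t
      twice-t+w = solve-∀
      t+2w : ∀ t h R C → t + (1ℤ + h) * (C - R * t) + (1ℤ + h) * (C - R * t) - (C - R * t) * (1ℤ + (h + h))
                         ≡ C - (R - 1ℤ) * t
      t+2w = solve-∀
      sum-c : ∀ t h R C → (C - R * t) * (1ℤ + (h + h)) ≡ t * R + (1ℤ + h) * (C - R * t) * + 2 - C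
      sum-c = solve-∀

    -- As K ∣ 2h, both E and E + h solve 2w ≡ C − R t modulo K; as K ∤ h, they cannot both make t + w vanish.
    evenModulus : ∀ {R C} h → K ∣ h + h → ¬ K ∣ h → ∀ t E → C ≡ R * t + (E + E) →
                  ¬ K ∣ t → ¬ K ∣ C - (R - 1ℤ) * t → Weights k R C
    evenModulus {R} h k∣2h k∤h t E refl k∤t k∤A with K ∣? t + E
    ... | no k∤t+E = record
      { m = 1 ; m≤3 = s≤s z≤n ; t = t ; w = E ; k∤t = k∤t ; k∤t+w = k∤t+E
      ; k∤t+2w  = k∤A ∘ subst (K ∣_) (t+2E t E R)
      ; k∣sum-c = divides 0ℤ (sum-c t E R K)
      }
      where
      t+2E : ∀ t E R → t + E + E ≡ R * t + (E + E) - (R - 1ℤ) * t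
      t+2E = solve-∀
      sum-c : ∀ t E R K → t * R + E * + 2 - (R * t + (E + E)) ≡ 0ℤ * K
      sum-c = solve-∀
    ... | yes k∣t+E = record
      { m = 1 ; m≤3 = s≤s z≤n ; t = t ; w = E + h ; k∤t = k∤t
      ; k∤t+w   = λ k∣t+w → k∤h (subst (K ∣_) (shift t E h) (∣m∣n⇒∣m-n k∣t+w k∣t+E))
      ; k∤t+2w  = λ k∣t+2w → k∤A (subst (K ∣_) (t+2w t E h R) (∣m∣n⇒∣m-n k∣t+2w k∣2h))
      ; k∣sum-c = subst (K ∣_) (sum-c t E h R) k∣2h
      }
      where
      shift : ∀ t E h → t + (E + h) - (t + E) ≡ h
      shift = solve-∀
      t+2w : ∀ t E h R → t + (E + h) + (E + h) - (h + h) ≡ R * t + (E + E) - (R - 1ℤ) * t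
      t+2w = solve-∀
      sum-c : ∀ t E h R → h + h ≡ t * R + (E + h) * + 2 - (R * t + (E + E))
      sum-c = solve-∀

    Blocked : ℤ → ℤ → ℤ → Set
    Blocked R C t = (K ∣ C - (R - 1ℤ) * t) ⊎ (K ∣ C - (R - + 2) * t)

    oddModulus-or-blocked : ∀ {R C} h → K ∣ 1ℤ + (h + h) → ∀ t → ¬ K ∣ t → Weights k R C ⊎ Blocked R C t
    oddModulus-or-blocked {R} {C} h k∣2h+1 t k∤t with K ∣? C - (R - 1ℤ) * t | K ∣? C - (R - + 2) * t
    ... | yes k∣A | _       = inj₂ (inj₁ k∣A)
    ... | no  _   | yes k∣B = inj₂ (inj₂ k∣B)
    ... | no  k∤A | no  k∤B = inj₁ (oddModulus h k∣2h+1 t k∤t k∤A k∤B)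

    halve : ∀ h → K ∣ 1ℤ + (h + h) → ∀ {z} → K ∣ z + z → K ∣ z
    halve h k∣2h+1 {z} k∣2z =
      subst (K ∣_) (identity h z) (∣m∣n⇒∣m-n (∣n⇒∣m*n (1ℤ + h) k∣2z) (∣n⇒∣m*n z k∣2h+1))
      where
      identity : ∀ h z → (1ℤ + h) * (z + z) - z * (1ℤ + (h + h)) ≡ z
      identity = solve-∀

    -- Each combination of blocking conditions at t = 1, −1, 2 yields 2C ≡ 0, C ≡ 0 or ±3 ≡ 0.
    blocked⇒k∣C : ∀ {R C} h → K ∣ 1ℤ + (h + h) →
                  Blocked R C 1ℤ → Blocked R C (- 1ℤ) → Blocked R C (+ 2) → K ∣ C
    blocked⇒k∣C {R} {C} h k∣2h+1 (inj₁ a₁) (inj₁ a₋₁) _ =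
      halve h k∣2h+1 (subst (K ∣_) (identity R C) (∣m∣n⇒∣m+n a₁ a₋₁))
      where
      identity : ∀ R C → C - (R - 1ℤ) * 1ℤ + (C - (R - 1ℤ) * - 1ℤ) ≡ C + C
      identity = solve-∀
    blocked⇒k∣C {R} {C} h k∣2h+1 (inj₂ b₁) (inj₂ b₋₁) _ =
      halve h k∣2h+1 (subst (K ∣_) (identity R C) (∣m∣n⇒∣m+n b₁ b₋₁))
      where
      identity : ∀ R C → C - (R - + 2) * 1ℤ + (C - (R - + 2) * - 1ℤ) ≡ C + C
      identity = solve-∀
    blocked⇒k∣C {R} {C} h k∣2h+1 (inj₁ a₁) (inj₂ _) (inj₁ a₂) =
      subst (K ∣_) (identity R C) (∣m∣n⇒∣m-n (∣n⇒∣m*n (+ 2) a₁) a₂)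
      where
      identity : ∀ R C → + 2 * (C - (R - 1ℤ) * 1ℤ) - (C - (R - 1ℤ) * + 2) ≡ C
      identity = solve-∀
    blocked⇒k∣C {R} {C} h k∣2h+1 (inj₂ b₁) (inj₁ _) (inj₂ b₂) =
      subst (K ∣_) (identity R C) (∣m∣n⇒∣m-n (∣n⇒∣m*n (+ 2) b₁) b₂)
      where
      identity : ∀ R C → + 2 * (C - (R - + 2) * 1ℤ) - (C - (R - + 2) * + 2) ≡ C
      identity = solve-∀
    blocked⇒k∣C {R} {C} h k∣2h+1 (inj₁ a₁) (inj₂ b₋₁) (inj₂ b₂) =
      ⊥-elim (k∤±≤4 (- + 3) (subst (K ∣_) (identity R C)
        (∣m∣n⇒∣m-n (∣n⇒∣m*n (+ 2) (∣m∣n⇒∣m-n (∣n⇒∣m*n (+ 2) a₁) b₂)) (∣m∣n⇒∣m+n a₁ b₋₁))))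
      where
      identity : ∀ R C → + 2 * (+ 2 * (C - (R - 1ℤ) * 1ℤ) - (C - (R - + 2) * + 2))
                         - (C - (R - 1ℤ) * 1ℤ + (C - (R - + 2) * - 1ℤ)) ≡ - + 3
      identity = solve-∀
    blocked⇒k∣C {R} {C} h k∣2h+1 (inj₂ b₁) (inj₁ a₋₁) (inj₁ a₂) =
      ⊥-elim (k∤±≤4 (+ 3) (subst (K ∣_) (identity R C)
        (∣m∣n⇒∣m-n (∣n⇒∣m*n (+ 2) (∣m∣n⇒∣m-n (∣n⇒∣m*n (+ 2) b₁) a₂)) (∣m∣n⇒∣m+n b₁ a₋₁))))
      where
      identity : ∀ R C → + 2 * (+ 2 * (C - (R - + 2) * 1ℤ) - (C - (R - 1ℤ) * + 2))
                         - (C - (R - + 2) * 1ℤ + (C - (R - 1ℤ) * - 1ℤ)) ≡ + 3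
      identity = solve-∀

    blocked-at-1⇒weights : ∀ {R C} → K ∣ C → Blocked R C 1ℤ → Weights k R C
    blocked-at-1⇒weights {R} {C} k∣C (inj₁ k∣A) =
      twoPermutations k∣C (subst (K ∣_) (identity R C) (∣n⇒∣m*n (+ 4) (∣m∣n⇒∣m-n k∣C k∣A)))
      where
      identity : ∀ R C → + 4 * (C - (C - (R - 1ℤ) * 1ℤ)) ≡ + 4 * (R - 1ℤ)
      identity = solve-∀
    blocked-at-1⇒weights {R} {C} k∣C (inj₂ k∣B) =
      threePermutations k∣C (subst (K ∣_) (identity R C) (∣n⇒∣m*n (+ 3) (∣m∣n⇒∣m-n k∣C k∣B)))
      where
      identity : ∀ R C → + 3 * (C - (C - (R - + 2) * 1ℤ)) ≡ + 3 * (R - + 2)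
      identity = solve-∀

    oddWeights : ∀ {R C} h → K ∣ 1ℤ + (h + h) → Weights k R C
    oddWeights {R} {C} h k∣2h+1
      with oddModulus-or-blocked h k∣2h+1 1ℤ     (k∤±≤4 1ℤ)
         | oddModulus-or-blocked h k∣2h+1 (- 1ℤ) (k∤±≤4 (- 1ℤ))
         | oddModulus-or-blocked h k∣2h+1 (+ 2)  (k∤±≤4 (+ 2))
    ... | inj₁ W  | _        | _       = W
    ... | inj₂ _  | inj₁ W   | _       = W
    ... | inj₂ _  | inj₂ _   | inj₁ W  = W
    ... | inj₂ b₁ | inj₂ b₋₁ | inj₂ b₂ =
      blocked-at-1⇒weights (blocked⇒k∣C {R} {C} h k∣2h+1 b₁ b₋₁ b₂) b₁

    even∤odd : ∀ h → K ≡ h + h → ∀ x → ¬ K ∣ 1ℤ + (x + x)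
    even∤odd h K≡2h x k∣odd with ∣1⇒≡1 (∣⇒∣ᵤ 2∣1)
      where
      double : ∀ h → h + h ≡ h * + 2
      double = solve-∀
      identity : ∀ x → 1ℤ + (x + x) - x * + 2 ≡ 1ℤ
      identity = solve-∀
      2∣K : + 2 ∣ K
      2∣K = divides h (trans K≡2h (double h))
      2∣1 : + 2 ∣ 1ℤ
      2∣1 = subst (+ 2 ∣_) (identity x) (∣m∣n⇒∣m-n (∣-trans 2∣K k∣odd) (divides x refl))
    ... | ()

    evenWeights : ∀ {R C} h → K ≡ h + h → ¬ K ∣ h → ∀ ρ → R ≡ 1ℤ + (ρ + ρ) →
                  (∃ λ γ → C ≡ γ + γ) ⊎ (∃ λ γ → C ≡ 1ℤ + (γ + γ)) → Weights k R C
    evenWeights h K≡2h k∤h ρ refl (inj₂ (γ , refl)) =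
      evenModulus h (subst (K ∣_) K≡2h ∣-refl) k∤h 1ℤ (γ - ρ) (identity γ ρ) (k∤±≤4 1ℤ)
        (even∤odd h K≡2h (γ - ρ) ∘ subst (K ∣_) (identity′ γ ρ))
      where
      identity : ∀ γ ρ → 1ℤ + (γ + γ) ≡ (1ℤ + (ρ + ρ)) * 1ℤ + ((γ - ρ) + (γ - ρ))
      identity = solve-∀
      identity′ : ∀ γ ρ → 1ℤ + (γ + γ) - (1ℤ + (ρ + ρ) - 1ℤ) * 1ℤ ≡ 1ℤ + ((γ - ρ) + (γ - ρ))
      identity′ = solve-∀
    evenWeights {R} h K≡2h k∤h _ _ (inj₁ (γ , refl)) =
      by-t=2-or-4 (K ∣? (γ + γ) - (R - 1ℤ) * + 2) (K ∣? (γ + γ) - (R - 1ℤ) * + 4)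
      where
      k∣2h : K ∣ h + h
      k∣2h = subst (K ∣_) K≡2h ∣-refl
      by-t=2-or-4 : Dec (K ∣ (γ + γ) - (R - 1ℤ) * + 2) → Dec (K ∣ (γ + γ) - (R - 1ℤ) * + 4) →
                    Weights k R (γ + γ)
      by-t=2-or-4 (no k∤A₂) _ =
        evenModulus h k∣2h k∤h (+ 2) (γ - R) (identity γ R) (k∤±≤4 (+ 2)) k∤A₂
        where
        identity : ∀ γ R → γ + γ ≡ R * + 2 + ((γ - R) + (γ - R))
        identity = solve-∀
      by-t=2-or-4 (yes _) (no k∤A₄) =
        evenModulus h k∣2h k∤h (+ 4) (γ - R - R) (identity γ R) (k∤±≤4 (+ 4)) k∤A₄
        where
        identity : ∀ γ R → γ + γ ≡ R * + 4 + ((γ - R - R) + (γ - R - R))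
        identity = solve-∀
      by-t=2-or-4 (yes k∣A₂) (yes k∣A₄) =
        twoPermutations k∣C (subst (K ∣_) (identity₄ γ R) (∣m∣n⇒∣m-n k∣C k∣A₄))
        where
        identity₂ : ∀ γ R → + 2 * ((γ + γ) - (R - 1ℤ) * + 2) - ((γ + γ) - (R - 1ℤ) * + 4) ≡ γ + γ
        identity₂ = solve-∀
        k∣C : K ∣ γ + γ
        k∣C = subst (K ∣_) (identity₂ γ R) (∣m∣n⇒∣m-n (∣n⇒∣m*n (+ 2) k∣A₂) k∣A₄)
        identity₄ : ∀ γ R → (γ + γ) - ((γ + γ) - (R - 1ℤ) * + 4) ≡ + 4 * (R - 1ℤ)
        identity₄ = solve-∀

  halves : ∀ n → + n ≡ + (n ℕ.% 2) + (+ (n ℕ./ 2) + + (n ℕ./ 2))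
  halves n = begin
    + n                                          ≡⟨ cong +_ (m≡m%n+[m/n]*n n 2) ⟩
    + (n ℕ.% 2 ℕ.+ n ℕ./ 2 ℕ.* 2)                ≡⟨ pos-+ (n ℕ.% 2) _ ⟩
    + (n ℕ.% 2) + + (n ℕ./ 2 ℕ.* 2)              ≡⟨ cong (λ x → + (n ℕ.% 2) + x) (pos-* (n ℕ./ 2) 2) ⟩
    + (n ℕ.% 2) + + (n ℕ./ 2) * + 2              ≡⟨ cong (λ x → + (n ℕ.% 2) + x) (double (+ (n ℕ./ 2))) ⟩
    + (n ℕ.% 2) + (+ (n ℕ./ 2) + + (n ℕ./ 2))    ∎
    where
    open ≡-Reasoning
    double : ∀ x → x * + 2 ≡ x + x
    double = solve-∀

  parity : ∀ n → (+ n ≡ + (n ℕ./ 2) + + (n ℕ./ 2)) ⊎ (+ n ≡ 1ℤ + (+ (n ℕ./ 2) + + (n ℕ./ 2)))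
  parity n with n ℕ.% 2 | m%n<n n 2 | halves n
  ... | 0           | _            | n≡2h   = inj₁ (trans n≡2h (+-identityˡ _))
  ... | 1           | _            | n≡2h+1 = inj₂ n≡2h+1
  ... | suc (suc _) | s≤s (s≤s ()) | _

  weights : ∀ {k} (k≥5 : 5 ℕ.≤ k) r c → Odd r → Weights k (+ r) (+ c)
  weights {k} k≥5 r c r-odd with parity k
  ... | inj₂ K≡2h+1 = oddWeights k≥5 (+ (k ℕ./ 2)) (subst (+ k ∣_) K≡2h+1 ∣-refl)
  ... | inj₁ K≡2h   = evenWeights k≥5 (+ (k ℕ./ 2)) K≡2h k∤h (+ (r ℕ./ 2)) R≡2ρ+1 C-parity
    where
    instance
      k≢0 : ℕ.NonZero k
      k≢0 = ℕ.>-nonZero (ℕ.<-≤-trans (s≤s z≤n) k≥5)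
    k∤h : ¬ + k ∣ + (k ℕ./ 2)
    k∤h = ∤-small (+ (k ℕ./ 2)) (m≥n⇒m/n>0 (ℕ.≤-trans (s≤s (s≤s z≤n)) k≥5)) (m/n<m k 2 (s≤s (s≤s z≤n)))
    R≡2ρ+1 : + r ≡ 1ℤ + (+ (r ℕ./ 2) + + (r ℕ./ 2))
    R≡2ρ+1 = subst (λ x → + r ≡ + x + (+ (r ℕ./ 2) + + (r ℕ./ 2))) r-odd (halves r)
    C-parity : (∃ λ γ → + c ≡ γ + γ) ⊎ (∃ λ γ → + c ≡ 1ℤ + (γ + γ))
    C-parity = Sum.map (+ (c ℕ./ 2) ,_) (+ (c ℕ./ 2) ,_) (parity c)

  -- Residues

  module _ (k : ℕ) .{{_ : ℕ.NonZero k}} where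

    private
      K : ℤ
      K = + k

    infix 4 _≈_
    record _≈_ (x : ℕ) (X : ℤ) : Set where
      constructor congruent
      field k∣x-X : K ∣ + x - X

    %ℕ-≈ : ∀ a → a %ℕ k ≈ a
    %ℕ-≈ a = congruent (divides (- (a /ℕ k)) (begin
      + (a %ℕ k) - a                            ≡⟨ cong (λ b → + (a %ℕ k) - b) (a≡a%ℕn+[a/ℕn]*n a k) ⟩
      + (a %ℕ k) - (+ (a %ℕ k) + a /ℕ k * K)    ≡⟨ identity (+ (a %ℕ k)) (a /ℕ k) K ⟩
      - (a /ℕ k) * K                            ∎))
      where
      open ≡-Reasoning
      identity : ∀ x q K → x - (x + q * K) ≡ - q * K
      identity = solve-∀

    +-≈ : ∀ {x y X Y} → x ≈ X → y ≈ Y → x ℕ.+ y ≈ X + Y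
    +-≈ {x} {y} {X} {Y} (congruent x≈X) (congruent y≈Y) = congruent
      (subst (K ∣_) (trans (identity (+ x) (+ y) X Y) (cong (_- (X + Y)) (sym (pos-+ x y)))) (∣m∣n⇒∣m+n x≈X y≈Y))
      where
      identity : ∀ x y X Y → x - X + (y - Y) ≡ x + y - (X + Y)
      identity = solve-∀

    *-≈ : ∀ {x X} → x ≈ X → ∀ a → x ℕ.* a ≈ X * + a
    *-≈ {x} {X} (congruent x≈X) a = congruent
      (subst (K ∣_) (trans (identity (+ x) X (+ a)) (cong (_- X * + a) (sym (pos-* x a)))) (∣m⇒∣m*n (+ a) x≈X))
      where
      identity : ∀ x X a → (x - X) * a ≡ x * a - X * a
      identity = solve-∀

    ≈-shift : ∀ {x X Y} → x ≈ X → K ∣ X - Y → x ≈ Y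
    ≈-shift {x} {X} {Y} (congruent x≈X) k∣X-Y =
      congruent (subst (K ∣_) (identity (+ x) X Y) (∣m∣n⇒∣m+n x≈X k∣X-Y))
      where
      identity : ∀ x X Y → x - X + (X - Y) ≡ x - Y
      identity = solve-∀

    ≈⇒%≢0 : ∀ {x X} → x ≈ X → ¬ K ∣ X → x ℕ.% k ≢ 0
    ≈⇒%≢0 {x} {X} (congruent x≈X) k∤X x%k≡0 =
      k∤X (subst (K ∣_) (identity (+ x) X) (∣m∣n⇒∣m-n (∣ᵤ⇒∣ {K} {+ x} (m%n≡0⇒n∣m x k x%k≡0)) x≈X))
      where
      identity : ∀ x X → x - (x - X) ≡ X
      identity = solve-∀

    ∤-gap : ∀ {u v} → u ℕ.< v → v ℕ.< k → ¬ K ∣ + u - + v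
    ∤-gap {u} {v} u<v v<k = ∤-small (u ⊖ v)
      (subst (0 ℕ.<_) (sym (∣⊖∣-< u<v)) (ℕ.m<n⇒0<n∸m u<v))
      (subst (ℕ._< k) (sym (∣⊖∣-< u<v)) (ℕ.≤-<-trans (ℕ.m∸n≤m v u) v<k))
      ∘ subst (K ∣_) ([+m]-[+n]≡m⊖n u v)

    residue-unique : ∀ {u v} → u ℕ.< k → v ℕ.< k → u ≈ + v → u ≡ v
    residue-unique {u} {v} u<k v<k (congruent k∣u-v) with ℕ.<-cmp u v
    ... | tri≈ _ u≡v _ = u≡v
    ... | tri< u<v _ _ = ⊥-elim (∤-gap u<v v<k k∣u-v)
    ... | tri> _ _ v<u = ⊥-elim (∤-gap v<u u<k (subst (K ∣_) (identity (+ u) (+ v)) (∣m⇒∣-m k∣u-v)))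
      where
      identity : ∀ u v → - (u - v) ≡ v - u
      identity = solve-∀

    ≈⇒mod≡ : ∀ {x} (c : Fin k) → x ≈ + toℕ c → x mod k ≡ c
    ≈⇒mod≡ {x} c (congruent k∣x-c) = toℕ-injective (trans (toℕ-fromℕ< (m%n<n x k))
      (residue-unique (m%n<n x k) (toℕ<n c) (≈-shift (%ℕ-≈ (+ x)) k∣x-c)))

  record ResidueWeights (k : ℕ) .{{_ : ℕ.NonZero k}} (r : ℕ) (c : Fin k) : Set where
    field
      m      : ℕ
      m≤3    : m ℕ.≤ 3
      t w    : ℕ
      t+jw≢0 : ∀ j → j ℕ.≤ 2 → (t ℕ.+ w ℕ.* j) ℕ.% k ≢ 0
      sum≡c  : (t ℕ.* r ℕ.+ w ℕ.* (m ℕ.+ m)) mod k ≡ c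

  toResidues : ∀ {k} .{{_ : ℕ.NonZero k}} {r} {c : Fin k} → Weights k (+ r) (+ toℕ c) → ResidueWeights k r c
  toResidues {k} {r} {c} W = record
    { m      = m
    ; m≤3    = m≤3
    ; t      = t %ℕ k
    ; w      = w %ℕ k
    ; t+jw≢0 = λ j j≤2 → ≈⇒%≢0 k (+-≈ k (%ℕ-≈ k t) (*-≈ k (%ℕ-≈ k w) j)) (k∤t+jw j j≤2)
    ; sum≡c  = ≈⇒mod≡ k c (≈-shift k (+-≈ k (*-≈ k (%ℕ-≈ k t) r) (*-≈ k (%ℕ-≈ k w) (m ℕ.+ m))) k∣sum-c)
    }
    where
    open Weights W
    k∤t+jw : ∀ j → j ℕ.≤ 2 → ¬ + k ∣ t + w * + j
    k∤t+jw 0 _ = k∤t ∘ subst (+ k ∣_) (identity t w)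
      where
      identity : ∀ t w → t + w * + 0 ≡ t
      identity = solve-∀
    k∤t+jw 1 _ = k∤t+w ∘ subst (+ k ∣_) (identity t w)
      where
      identity : ∀ t w → t + w * + 1 ≡ t + w
      identity = solve-∀
    k∤t+jw 2 _ = k∤t+2w ∘ subst (+ k ∣_) (identity t w)
      where
      identity : ∀ t w → t + w * + 2 ≡ t + w + w
      identity = solve-∀
    k∤t+jw (suc (suc (suc _))) (s≤s (s≤s ()))

-- Opened only here, since the integer operators of Arithmetic bear the same names.
open import Data.Nat.Base using (_+_; _*_; _%_; _≤_; _<_; _≥_)
open import Data.Nat.Properties
  using (≤-refl; ≤-reflexive; ≤-trans; ≤-pred; n<1+n; ≮⇒≥; ≰⇒>; m≤n⇒m<n∨m≡n; suc-injective;
         +-comm; +-suc; +-mono-≤; +-monoʳ-≤; +-cancelʳ-≤; *-cancelʳ-≤; *-identityʳ; *-zeroʳ; *-distribʳ-+;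
         _≤?_; +-*-semiring; module ≤-Reasoning)
open import Algebra.Properties.Semiring.Sum +-*-semiring
  using (sum; sum-cong-≗; sum-replicate-zero; ∑-distrib-+; ∑-comm; *-distribˡ-sum; *-distribʳ-sum)
open import Data.Nat.DivMod using (_mod_; m%n<n; m%n%n≡m%n; %-distribˡ-+)
open import Data.Nat.Induction using (<-rec)
open Arithmetic using (weights; ResidueWeights; toResidues)

open Equivalence using (to; from)

private
  variable
    m n d : ℕ
    P Q Q′ : Fin n → Bool

-- Counting elements of Boolean predicates on Fin n

ind : Bool → ℕ
ind b = if b then 1 else 0

count : (Fin n → Bool) → ℕ
count P = sum (λ i → ind (P i))

infix 4 _⊆_
_⊆_ : (Fin n → Bool) → (Fin n → Bool) → Set
P ⊆ Q = ∀ i → T (P i) → T (Q i)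

⁅_⁆ : Fin n → Fin n → Bool
⁅ j ⁆ i = ⌊ i ≟ j ⌋

infixl 5 _∖_
_∖_ : (Fin n → Bool) → (Fin n → Bool) → Fin n → Bool
(P ∖ Q) i = not (Q i) ∧ P i

T-not⇒¬T : ∀ {b} → T (not b) → ¬ T b
T-not⇒¬T {false} _ ()

¬T⇒T-not : ∀ {b} → ¬ T b → T (not b)
¬T⇒T-not {false} _  = tt
¬T⇒T-not {true}  ¬b = ¬b tt

j∈⁅j⁆ : (j : Fin n) → T (⁅ j ⁆ j)
j∈⁅j⁆ j = fromWitness {a? = j ≟ j} refl

∈-∖⁺ : ∀ {p q} → T p → ¬ T q → T (not q ∧ p)
∈-∖⁺ p ¬q = from T-∧ (¬T⇒T-not ¬q , p)

∈-∖⇒∉ : ∀ {p q} → T (not q ∧ p) → ¬ T q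
∈-∖⇒∉ = T-not⇒¬T ∘ proj₁ ∘ to T-∧

∈-∖⇒∈ : ∀ {p q} → T (not q ∧ p) → T p
∈-∖⇒∈ = proj₂ ∘ to T-∧

∖-⊆ : P ∖ Q ⊆ P
∖-⊆ _ = ∈-∖⇒∈

sum-mono : {f g : Fin n → ℕ} → (∀ i → f i ≤ g i) → sum f ≤ sum g
sum-mono {zero}  _   = z≤n
sum-mono {suc n} f≤g = +-mono-≤ (f≤g zero) (sum-mono (f≤g ∘ suc))

count-cong : (∀ i → P i ≡ Q i) → count P ≡ count Q
count-cong P≗Q = sum-cong-≗ (cong ind ∘ P≗Q)

count-mono : P ⊆ Q → count P ≤ count Q
count-mono P⊆Q = sum-mono (λ i → ind-mono (P⊆Q i))
  where
  ind-mono : ∀ {a b} → (T a → T b) → ind a ≤ ind b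
  ind-mono {false}         _   = z≤n
  ind-mono {true}  {true}  _   = ≤-refl
  ind-mono {true}  {false} a⇒b = ⊥-elim (a⇒b tt)

count-≤-+ : (∀ i → T (P i) → T (Q i) ⊎ T (Q′ i)) → count P ≤ count Q + count Q′
count-≤-+ {Q = Q} {Q′ = Q′} cover =
  ≤-trans (sum-mono (λ i → ind-≤ (cover i))) (≤-reflexive (∑-distrib-+ (ind ∘ Q) (ind ∘ Q′)))
  where
  ind-≤ : ∀ {a b c} → (T a → T b ⊎ T c) → ind a ≤ ind b + ind c
  ind-≤ {false}                 _ = z≤n
  ind-≤ {true}  {true}          _ = s≤s z≤n
  ind-≤ {true}  {false} {true}  _ = s≤s z≤n
  ind-≤ {true}  {false} {false} a⇒b⊎c with a⇒b⊎c tt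
  ... | inj₁ ()
  ... | inj₂ ()

count-∨ : (∀ i → T (P i) → ¬ T (Q i)) → count (λ i → P i ∨ Q i) ≡ count P + count Q
count-∨ {P = P} {Q = Q} disjoint =
  trans (sum-cong-≗ (λ i → ind-∨ (disjoint i))) (∑-distrib-+ (ind ∘ P) (ind ∘ Q))
  where
  ind-∨ : ∀ {a b} → (T a → ¬ T b) → ind (a ∨ b) ≡ ind a + ind b
  ind-∨ {false}         _    = refl
  ind-∨ {true}  {false} _    = refl
  ind-∨ {true}  {true}  a⇒¬b = ⊥-elim (a⇒¬b tt tt)

-- ⌊ suc i ≟ suc j ⌋ does not reduce to ⌊ i ≟ j ⌋; ⌊⌋-map′ relates them.
count-singleton : (j : Fin n) → count ⁅ j ⁆ ≡ 1
count-singleton {suc n} zero    = cong suc (sum-replicate-zero n)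
count-singleton {suc n} (suc j) = trans (count-cong (λ i → ⌊⌋-map′ _ _ (i ≟ j))) (count-singleton j)

count-remove : ∀ {j} → T (P j) → count P ≡ suc (count (P ∖ ⁅ j ⁆))
count-remove {P = P} {zero} Pj with P zero
... | true = refl
count-remove {P = P} {suc j} Pj = begin
  ind (P zero) + count (P ∘ suc)                ≡⟨ cong (ind (P zero) +_) (count-remove {P = P ∘ suc} Pj) ⟩
  ind (P zero) + suc (count (P ∘ suc ∖ ⁅ j ⁆))  ≡⟨ +-suc (ind (P zero)) _ ⟩
  suc (ind (P zero) + count (P ∘ suc ∖ ⁅ j ⁆))  ≡⟨ cong (λ x → suc (ind (P zero) + x)) (count-cong shift) ⟨
  suc (count (P ∖ ⁅ suc j ⁆))                   ∎
  where
  open ≡-Reasoning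
  shift : ∀ i → (P ∖ ⁅ suc j ⁆) (suc i) ≡ (P ∘ suc ∖ ⁅ j ⁆) i
  shift i = cong (λ b → not b ∧ P (suc i)) (⌊⌋-map′ _ _ (i ≟ j))

count-< : ∀ {j} → P ⊆ Q → T (Q j) → ¬ T (P j) → count P < count Q
count-< {P = P} {Q = Q} {j} P⊆Q Qj ¬Pj = begin-strict
  count P                    ≤⟨ count-mono P⊆Q∖j ⟩
  count (Q ∖ ⁅ j ⁆)          <⟨ n<1+n _ ⟩
  suc (count (Q ∖ ⁅ j ⁆))    ≡⟨ count-remove {P = Q} Qj ⟨
  count Q                    ∎
  where
  open ≤-Reasoning
  P⊆Q∖j : P ⊆ Q ∖ ⁅ j ⁆
  P⊆Q∖j i Pi with i ≟ j
  ... | yes refl = ¬Pj Pi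
  ... | no  _    = P⊆Q i Pi

count-pos : 0 < count P → ∃ λ i → T (P i)
count-pos {suc n} {P} 0<count with P zero in eq
... | true  = zero , subst T (sym eq) tt
... | false with count-pos {P = P ∘ suc} 0<count
...   | i , Pi = suc i , Pi

-- Hall's theorem

module _ {m n : ℕ} (R : Fin m → Fin n → Bool) where

  adjacent? : (S : Fin m → Bool) (b : Fin n) → Dec (∃ λ a → T (S a) × T (R a b))
  adjacent? S b = any? (λ a → T? (S a) ×-dec T? (R a b))

  neighbours : (Fin n → Bool) → (Fin m → Bool) → Fin n → Bool
  neighbours B S b = B b ∧ ⌊ adjacent? S b ⌋

  HallCondition : (Fin m → Bool) → (Fin n → Bool) → Set
  HallCondition A B = ∀ S → S ⊆ A → count S ≤ count (neighbours B S)

  record Matching (A : Fin m → Bool) (B : Fin n → Bool) : Set where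
    field
      match     : ∀ {a} → T (A a) → Fin n
      into      : ∀ {a} (a∈A : T (A a)) → T (B (match a∈A))
      along     : ∀ {a} (a∈A : T (A a)) → T (R a (match a∈A))
      injective : ∀ {a a′} (a∈A : T (A a)) (a′∈A : T (A a′)) → match a∈A ≡ match a′∈A → a ≡ a′

  open Matching

  private
    variable
      A S S′ : Fin m → Bool
      B B₁ : Fin n → Bool

  neighbour : ∀ {a b} → T (B b) → T (S a) → T (R a b) → T (neighbours B S b)
  neighbour Bb Sa aRb = from T-∧ (Bb , fromWitness (_ , Sa , aRb))

  neighbour⁻ : ∀ {b} → T (neighbours B S b) → T (B b) × ∃ λ a → T (S a) × T (R a b)
  neighbour⁻ b∈N = let Bb , adjacent = to T-∧ b∈N in Bb , toWitness adjacent

  neighbours-cong : (∀ i → S i ≡ S′ i) → ∀ b → neighbours B S b ≡ neighbours B S′ b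
  neighbours-cong {S = S} {S′ = S′} {B = B} S≗S′ b = cong (B b ∧_) $ begin
    ⌊ adjacent? S b ⌋      ≡⟨ isYes≗does (adjacent? S b) ⟩
    does (adjacent? S b)   ≡⟨ does-⇔ (mk⇔ (transfer {S} {S′} S≗S′) (transfer {S′} {S} (sym ∘ S≗S′)))
                                     (adjacent? S b) (adjacent? S′ b) ⟩
    does (adjacent? S′ b)  ≡⟨ isYes≗does (adjacent? S′ b) ⟨
    ⌊ adjacent? S′ b ⌋     ∎
    where
    open ≡-Reasoning
    transfer : ∀ {S S′} → (∀ i → S i ≡ S′ i) →
               (∃ λ a → T (S a) × T (R a b)) → ∃ λ a → T (S′ a) × T (R a b)
    transfer S≗S′ (a , Sa , aRb) = a , subst T (S≗S′ a) Sa , aRb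

  -- Either some nonempty proper subset S of A is critical,
  -- and A splits into S, matched into N(S), and A ∖ S, matched outside N(S); or every such
  -- subset has a surplus neighbour, and any single edge can be matched first.
  Critical : (Fin m → Bool) → (Fin n → Bool) → (Fin m → Bool) → Set
  Critical A B S = S ⊆ A × (∃ λ s → T (S s)) × (∃ λ a → T (A a) × T (not (S a)))
                 × count (neighbours B S) ≤ count S

  critical? : ∀ A B S → Dec (Critical A B S)
  critical? A B S = all? (λ i → T? (S i) →-dec T? (A i))
                ×-dec any? (T? ∘ S)
                ×-dec any? (λ a → T? (A a) ×-dec T? (not (S a)))
                ×-dec count (neighbours B S) ≤? count S

  critical-resp : (∀ i → S i ≡ S′ i) → Critical A B S → Critical A B S′
  critical-resp {B = B} S≗S′ (S⊆A , (s , Ss) , (a , Aa , a∉S) , tight) =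
      (λ i S′i → S⊆A i (subst T (sym (S≗S′ i)) S′i))
    , (s , subst T (S≗S′ s) Ss)
    , (a , Aa , subst (T ∘ not) (S≗S′ a) a∉S)
    , subst₂ _≤_ (count-cong (neighbours-cong S≗S′)) (count-cong S≗S′) tight

  Smaller : (Fin m → Bool) → Set
  Smaller A = ∀ A′ B′ → count A′ < count A → HallCondition A′ B′ → Matching A′ B′

  glue : S ⊆ A → B₁ ⊆ B → Matching S B₁ → Matching (A ∖ S) (B ∖ B₁) → Matching A B
  glue {S = S} {A = A} {B₁ = B₁} {B = B} S⊆A B₁⊆B M₁ M₂ = record
    { match     = glued
    ; into      = into′
    ; along     = along′
    ; injective = injective′
    }
    where
    split : ∀ {a} → T (A a) → T (S a) ⊎ T ((A ∖ S) a)
    split {a} Aa with T? (S a)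
    ... | yes Sa = inj₁ Sa
    ... | no ¬Sa = inj₂ (∈-∖⁺ Aa ¬Sa)

    glued : ∀ {a} → T (A a) → Fin n
    glued = [ match M₁ , match M₂ ]′ ∘ split

    into′ : ∀ {a} (a∈A : T (A a)) → T (B (glued a∈A))
    into′ a∈A with split a∈A
    ... | inj₁ a∈S   = B₁⊆B _ (into M₁ a∈S)
    ... | inj₂ a∈A∖S = ∈-∖⇒∈ (into M₂ a∈A∖S)

    along′ : ∀ {a} (a∈A : T (A a)) → T (R a (glued a∈A))
    along′ a∈A with split a∈A
    ... | inj₁ a∈S   = along M₁ a∈S
    ... | inj₂ a∈A∖S = along M₂ a∈A∖S

    injective′ : ∀ {a a′} (a∈A : T (A a)) (a′∈A : T (A a′)) → glued a∈A ≡ glued a′∈A → a ≡ a′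
    injective′ a∈A a′∈A same with split a∈A | split a′∈A
    ... | inj₁ x | inj₁ y = injective M₁ x y same
    ... | inj₂ x | inj₂ y = injective M₂ x y same
    ... | inj₁ x | inj₂ y = ⊥-elim (∈-∖⇒∉ (into M₂ y) (subst (T ∘ B₁) same (into M₁ x)))
    ... | inj₂ x | inj₁ y = ⊥-elim (∈-∖⇒∉ (into M₂ x) (subst (T ∘ B₁) (sym same) (into M₁ y)))

  singleton-matching : ∀ {a₀ b₀} → T (R a₀ b₀) → Matching ⁅ a₀ ⁆ ⁅ b₀ ⁆
  singleton-matching {a₀} {b₀} a₀Rb₀ = record
    { match     = λ _ → b₀
    ; into      = λ _ → j∈⁅j⁆ b₀
    ; along     = λ a≡a₀ → subst (λ a → T (R a b₀)) (sym (toWitness a≡a₀)) a₀Rb₀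
    ; injective = λ a≡a₀ a′≡a₀ _ → trans (toWitness a≡a₀) (sym (toWitness a′≡a₀))
    }

  empty-matching : (∀ a → ¬ T (A a)) → Matching A B
  empty-matching A≡∅ = record
    { match     = λ a∈A → ⊥-elim (A≡∅ _ a∈A)
    ; into      = λ a∈A → ⊥-elim (A≡∅ _ a∈A)
    ; along     = λ a∈A → ⊥-elim (A≡∅ _ a∈A)
    ; injective = λ a∈A _ _ → ⊥-elim (A≡∅ _ a∈A)
    }

  match-critical : Smaller A → HallCondition A B → Critical A B S → Matching A B
  match-critical {A = A} {B = B} {S = S} smaller hall (S⊆A , (s , Ss) , (a₀ , Aa₀ , a₀∉S) , tight) =
    glue S⊆A N⊆B (smaller S N |S|<|A| hall-inside) (smaller (A ∖ S) (B ∖ N) |A∖S|<|A| hall-outside)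
    where
    N : Fin n → Bool
    N = neighbours B S

    N⊆B : N ⊆ B
    N⊆B b = proj₁ ∘ neighbour⁻ {B = B} {S = S}

    |S|<|A| : count S < count A
    |S|<|A| = count-< S⊆A Aa₀ (T-not⇒¬T a₀∉S)

    |A∖S|<|A| : count (A ∖ S) < count A
    |A∖S|<|A| = count-< {P = A ∖ S} ∖-⊆ (S⊆A s Ss) (λ s∈A∖S → ∈-∖⇒∉ s∈A∖S Ss)

    hall-inside : HallCondition S N
    hall-inside U U⊆S = ≤-trans (hall U (λ a → S⊆A a ∘ U⊆S a)) (count-mono {P = neighbours B U} λ b b∈N[U] →
      let Bb , a , Ua , aRb = neighbour⁻ {B = B} {S = U} b∈N[U]
      in  neighbour {B = N} (neighbour {B = B} {S = S} Bb (U⊆S a Ua) aRb) Ua aRb)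

    hall-outside : HallCondition (A ∖ S) (B ∖ N)
    hall-outside U U⊆A∖S = +-cancelʳ-≤ (count S) (count U) _ $ begin
      count U + count S                          ≡⟨ count-∨ {P = U} U∩S≡∅ ⟨
      count (λ a → U a ∨ S a)                    ≤⟨ hall _ U∪S⊆A ⟩
      count (neighbours B (λ a → U a ∨ S a))     ≤⟨ count-≤-+ {P = neighbours B (λ a → U a ∨ S a)} cover ⟩
      count (neighbours (B ∖ N) U) + count N     ≤⟨ +-monoʳ-≤ _ tight ⟩
      count (neighbours (B ∖ N) U) + count S     ∎
      where
      open ≤-Reasoning
      U∩S≡∅ : ∀ a → T (U a) → ¬ T (S a)
      U∩S≡∅ a Ua = ∈-∖⇒∉ (U⊆A∖S a Ua)
      U∪S⊆A : (λ a → U a ∨ S a) ⊆ A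
      U∪S⊆A a U∨S with to T-∨ U∨S
      ... | inj₁ Ua = ∈-∖⇒∈ (U⊆A∖S a Ua)
      ... | inj₂ Sa = S⊆A a Sa
      cover : ∀ b → T (neighbours B (λ a → U a ∨ S a) b) → T (neighbours (B ∖ N) U b) ⊎ T (N b)
      cover b b∈ with neighbour⁻ {B = B} {S = λ a → U a ∨ S a} b∈ | T? (N b)
      ... | _                  | yes Nb = inj₂ Nb
      ... | Bb , a , U∨S , aRb | no ¬Nb with to T-∨ U∨S
      ...   | inj₁ Ua = inj₁ (neighbour {B = B ∖ N} (∈-∖⁺ Bb ¬Nb) Ua aRb)
      ...   | inj₂ Sa = ⊥-elim (¬Nb (neighbour {B = B} {S = S} Bb Sa aRb))

  match-surplus : Smaller A → HallCondition A B → (∀ S → ¬ Critical A B S) →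
                  ∀ {a₀} → T (A a₀) → Matching A B
  match-surplus {A = A} {B = B} smaller hall no-critical {a₀} Aa₀ =
    glue ⁅a₀⁆⊆A ⁅b₀⁆⊆B (singleton-matching a₀Rb₀)
         (smaller (A ∖ ⁅ a₀ ⁆) (B ∖ ⁅ b₀ ⁆) |A∖a₀|<|A| hall-rest)
    where
    ⁅a₀⁆⊆A : ⁅ a₀ ⁆ ⊆ A
    ⁅a₀⁆⊆A a a≡a₀ = subst (T ∘ A) (sym (toWitness a≡a₀)) Aa₀

    b₀-adjacent : ∃ λ b → T (neighbours B ⁅ a₀ ⁆ b)
    b₀-adjacent =
      count-pos (subst (_≤ count (neighbours B ⁅ a₀ ⁆)) (count-singleton a₀) (hall ⁅ a₀ ⁆ ⁅a₀⁆⊆A))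

    b₀ : Fin n
    b₀ = proj₁ b₀-adjacent

    a₀Rb₀ : T (R a₀ b₀)
    a₀Rb₀ with neighbour⁻ {B = B} {S = ⁅ a₀ ⁆} (proj₂ b₀-adjacent)
    ... | _ , a , a≡a₀ , aRb₀ = subst (λ a → T (R a b₀)) (toWitness a≡a₀) aRb₀

    ⁅b₀⁆⊆B : ⁅ b₀ ⁆ ⊆ B
    ⁅b₀⁆⊆B b b≡b₀ =
      subst (T ∘ B) (sym (toWitness b≡b₀)) (proj₁ (neighbour⁻ {B = B} {S = ⁅ a₀ ⁆} (proj₂ b₀-adjacent)))

    |A∖a₀|<|A| : count (A ∖ ⁅ a₀ ⁆) < count A
    |A∖a₀|<|A| =
      count-< {P = A ∖ ⁅ a₀ ⁆} ∖-⊆ Aa₀ (λ a₀∈A∖a₀ → ∈-∖⇒∉ a₀∈A∖a₀ (j∈⁅j⁆ a₀))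

    hall-rest : HallCondition (A ∖ ⁅ a₀ ⁆) (B ∖ ⁅ b₀ ⁆)
    hall-rest U U⊆A∖a₀ with any? (T? ∘ U)
    ... | no  U≡∅      = ≤-trans (≮⇒≥ (U≡∅ ∘ count-pos)) z≤n
    ... | yes (s , Us) = ≤-pred $ begin-strict
      count U                                            <⟨ ≰⇒> (no-critical U ∘ critical) ⟩
      count (neighbours B U)                             ≤⟨ count-≤-+ {P = neighbours B U} cover ⟩
      count (neighbours (B ∖ ⁅ b₀ ⁆) U) + count ⁅ b₀ ⁆   ≡⟨ cong (count (neighbours (B ∖ ⁅ b₀ ⁆) U) +_) (count-singleton b₀) ⟩
      count (neighbours (B ∖ ⁅ b₀ ⁆) U) + 1              ≡⟨ +-comm _ 1 ⟩
      suc (count (neighbours (B ∖ ⁅ b₀ ⁆) U))            ∎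
      where
      open ≤-Reasoning
      U⊆A : U ⊆ A
      U⊆A a = ∈-∖⇒∈ ∘ U⊆A∖a₀ a
      a₀∉U : ¬ T (U a₀)
      a₀∉U Ua₀ = ∈-∖⇒∉ (U⊆A∖a₀ a₀ Ua₀) (j∈⁅j⁆ a₀)
      critical : count (neighbours B U) ≤ count U → Critical A B U
      critical tight = U⊆A , (s , Us) , (a₀ , Aa₀ , ¬T⇒T-not a₀∉U) , tight
      cover : ∀ b → T (neighbours B U b) → T (neighbours (B ∖ ⁅ b₀ ⁆) U b) ⊎ T (⁅ b₀ ⁆ b)
      cover b b∈ with neighbour⁻ {B = B} {S = U} b∈ | T? (⁅ b₀ ⁆ b)
      ... | _                 | yes b≡b₀ = inj₂ b≡b₀
      ... | Bb , a , Ua , aRb | no  b≢b₀ = inj₁ (neighbour {B = B ∖ ⁅ b₀ ⁆} (∈-∖⁺ Bb b≢b₀) Ua aRb)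

  hall-step : Smaller A → HallCondition A B → Matching A B
  hall-step {A = A} {B = B} smaller hall-AB with any? (T? ∘ A)
  ... | no  A≡∅        = empty-matching (λ a Aa → A≡∅ (a , Aa))
  ... | yes (a₀ , Aa₀) with anySubset? (λ s → critical? A B (lookup s))
  ...   | yes (_ , critical) = match-critical smaller hall-AB critical
  ...   | no  ∄critical      = match-surplus smaller hall-AB no-critical Aa₀
    where
    no-critical : ∀ S → ¬ Critical A B S
    no-critical S critical = ∄critical (tabulate S , critical-resp (sym ∘ lookup∘tabulate S) critical)

  hall : ∀ A B → HallCondition A B → Matching A B
  hall A B = <-rec Goal step (count A) A B refl
    where
    Goal : ℕ → Set
    Goal s = ∀ A B → count A ≡ s → HallCondition A B → Matching A B
    step : ∀ s → (∀ {s′} → s′ < s → Goal s′) → Goal s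
    step _ smaller A B refl = hall-step (λ A′ B′ |A′|<|A| → smaller |A′|<|A| A′ B′ refl)

-- Regular relations and their regular subrelations

record Biregular (d : ℕ) (R : Fin m → Fin n → Bool) : Set where
  field
    out-degree : ∀ a → count (R a) ≡ d
    in-degree  : ∀ b → count (λ a → R a b) ≡ d

open Biregular

-- Double counting the pairs (a, b) with a ∈ S and R a b: (d + 1)|S| ≤ (d + 1)|N(S)|.
biregular⇒hallCondition : ∀ {R : Fin m → Fin n → Bool} → Biregular (suc d) R →
                          HallCondition R (λ _ → true) (λ _ → true)
biregular⇒hallCondition {n = n} {d = d} {R = R} regular S _ = *-cancelʳ-≤ (count S) (count N) (suc d) $ begin
  count S * suc d                                   ≡⟨ *-distribʳ-sum (suc d) (ind ∘ S) ⟩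
  sum (λ a → ind (S a) * suc d)                     ≡⟨ sum-cong-≗ (λ a → cong (ind (S a) *_) (out-degree regular a)) ⟨
  sum (λ a → ind (S a) * count (R a))               ≡⟨ sum-cong-≗ (λ a → *-distribˡ-sum (ind (S a)) (ind ∘ R a)) ⟩
  sum (λ a → sum (λ b → ind (S a) * ind (R a b)))   ≤⟨ sum-mono (λ a → sum-mono (λ b → adjacent-counted a b)) ⟩
  sum (λ a → sum (λ b → ind (N b) * ind (R a b)))   ≡⟨ ∑-comm (λ a b → ind (N b) * ind (R a b)) ⟩
  sum (λ b → sum (λ a → ind (N b) * ind (R a b)))   ≡⟨ sum-cong-≗ (λ b → *-distribˡ-sum (ind (N b)) (λ a → ind (R a b))) ⟨
  sum (λ b → ind (N b) * count (λ a → R a b))       ≡⟨ sum-cong-≗ (λ b → cong (ind (N b) *_) (in-degree regular b)) ⟩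
  sum (λ b → ind (N b) * suc d)                     ≡⟨ *-distribʳ-sum (suc d) (ind ∘ N) ⟨
  count N * suc d                                   ∎
  where
  open ≤-Reasoning
  N : Fin n → Bool
  N = neighbours R (λ _ → true) S
  ind-*-mono : ∀ {x y z} → (T x → T y → T z) → ind x * ind y ≤ ind z * ind y
  ind-*-mono {false}                 _     = z≤n
  ind-*-mono {true}  {false}         _     = z≤n
  ind-*-mono {true}  {true}  {true}  _     = ≤-refl
  ind-*-mono {true}  {true}  {false} x⇒y⇒z = ⊥-elim (x⇒y⇒z tt tt)
  adjacent-counted : ∀ a b → ind (S a) * ind (R a b) ≤ ind (N b) * ind (R a b)
  adjacent-counted a b = ind-*-mono {S a} {R a b} {N b} (neighbour R tt)

injective⇒surjective : ∀ {σ : Fin n → Fin n} → (∀ {a a′} → σ a ≡ σ a′ → a ≡ a′) →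
                       ∀ b → ∃ λ a → σ a ≡ b
injective⇒surjective {suc n} {σ} σ-injective b with any? (λ a → σ a ≟ b)
... | yes hit = hit
... | no  b∉σ with pigeonhole (n<1+n n) (λ a → punchOut {i = b} {j = σ a} (b∉σ ∘ (a ,_) ∘ sym))
...   | i , j , i<j , same =
  ⊥-elim (<ᶠ-irrefl (σ-injective (punchOut-injective {i = b} (b∉σ ∘ (i ,_) ∘ sym) (b∉σ ∘ (j ,_) ∘ sym) same))
                    i<j)

record PerfectMatching (R : Fin n → Fin n → Bool) : Set where
  field
    σ           : Fin n → Fin n
    σ-along     : ∀ a → T (R a (σ a))
    σ-injective : ∀ {a a′} → σ a ≡ σ a′ → a ≡ a′

open PerfectMatching

perfectMatching : ∀ {R : Fin n → Fin n → Bool} → Biregular (suc d) R → PerfectMatching R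
perfectMatching {R = R} regular = record
  { σ           = λ _ → match tt
  ; σ-along     = λ _ → along tt
  ; σ-injective = injective tt tt
  }
  where open Matching (hall R (λ _ → true) (λ _ → true) (biregular⇒hallCondition regular))

_without_ : (R : Fin n → Fin n → Bool) → PerfectMatching R → Fin n → Fin n → Bool
(R without M) a = R a ∖ ⁅ σ M a ⁆

without-biregular : ∀ {R : Fin n → Fin n → Bool} → Biregular (suc d) R → (M : PerfectMatching R) →
                    Biregular d (R without M)
without-biregular {d = d} {R = R} regular M = record
  { out-degree = λ a → suc-injective (trans (sym (count-remove {P = R a} (σ-along M a))) (out-degree regular a))
  ; in-degree  = in-degree′
  }
  where
  in-degree′ : ∀ b → count (λ a → (R without M) a b) ≡ d
  in-degree′ b with injective⇒surjective (σ-injective M) b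
  ... | a₀ , σa₀≡b = suc-injective $ begin
    suc (count (λ a → (R without M) a b))  ≡⟨ cong suc (count-cong (λ a → cong (λ x → not x ∧ R a b) (hit-once a))) ⟩
    suc (count ((λ a → R a b) ∖ ⁅ a₀ ⁆))   ≡⟨ count-remove {P = λ a → R a b} (subst (T ∘ R a₀) σa₀≡b (σ-along M a₀)) ⟨
    count (λ a → R a b)                    ≡⟨ in-degree regular b ⟩
    suc d                                  ∎
    where
    open ≡-Reasoning
    hit-once : ∀ a → ⌊ b ≟ σ M a ⌋ ≡ ⌊ a ≟ a₀ ⌋
    hit-once a with b ≟ σ M a | a ≟ a₀
    ... | yes _    | yes _    = refl
    ... | no  _    | no  _    = refl
    ... | yes b≡σa | no  a≢a₀ = ⊥-elim (a≢a₀ (σ-injective M (trans (sym b≡σa) (sym σa₀≡b))))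
    ... | no  b≢σa | yes refl = ⊥-elim (b≢σa (sym σa₀≡b))

regular-subrelation : ∀ {R : Fin n → Fin n → Bool} → m ≤ d → Biregular d R →
                      ∃ λ F → (∀ a b → T (F a b) → T (R a b)) × Biregular m F
regular-subrelation {R = R} m≤d regular with m≤n⇒m<n∨m≡n m≤d
... | inj₂ refl = R , (λ _ _ aRb → aRb) , regular
regular-subrelation {d = suc d} {R = R} _ regular | inj₁ (s≤s m≤d)
  with regular-subrelation m≤d (without-biregular regular (perfectMatching regular))
... | F , F⊆R∖M , F-regular = F , (λ a b → ∈-∖⇒∈ ∘ F⊆R∖M a b) , F-regular

-- The labeling

%-sum-cong : ∀ {f g : Fin n → ℕ} k .{{_ : NonZero k}} → (∀ i → f i % k ≡ g i % k) → sum f % k ≡ sum g % k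
%-sum-cong {zero}          k _   = refl
%-sum-cong {suc n} {f} {g} k f≈g = begin
  (f zero + sum (f ∘ suc)) % k           ≡⟨ %-distribˡ-+ (f zero) _ k ⟩
  (f zero % k + sum (f ∘ suc) % k) % k   ≡⟨ cong₂ (λ x y → (x + y) % k) (f≈g zero) (%-sum-cong k (f≈g ∘ suc)) ⟩
  (g zero % k + sum (g ∘ suc) % k) % k   ≡⟨ %-distribˡ-+ (g zero) _ k ⟨
  (g zero + sum (g ∘ suc)) % k           ∎
  where open ≡-Reasoning

adjacency-biregular : ∀ {r} (G : SimpleGraph n) → Regular r G → Biregular r (adj G)
adjacency-biregular G regular = record
  { out-degree = regular
  ; in-degree  = λ b → trans (count-cong (λ a → symmetric G a b)) (regular b)
  }

module _ {r : ℕ} (G : SimpleGraph n) (G-regular : Regular r G)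
         (F : Fin n → Fin n → Bool) (F⊆G : ∀ u v → T (F u v) → T (adj G u v)) (F-regular : Biregular m F)
         (k : ℕ) .{{_ : NonZero k}} (t w : ℕ) where

  crossings : Fin n → Fin n → ℕ
  crossings u v = ind (F u v) + ind (F v u)

  weight : Fin n → Fin n → ℕ
  weight u v = t + w * crossings u v

  crossings≤2 : ∀ u v → crossings u v ≤ 2
  crossings≤2 u v = +-mono-≤ (ind≤1 (F u v)) (ind≤1 (F v u))
    where
    ind≤1 : ∀ b → ind b ≤ 1
    ind≤1 false = z≤n
    ind≤1 true  = ≤-refl

  crossings-off-edge : ∀ {u v} → adj G u v ≡ false → crossings u v ≡ 0
  crossings-off-edge {u} {v} no-edge = cong₂ _+_ (F-off-edge no-edge) (F-off-edge (trans (symmetric G v u) no-edge))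
    where
    F-off-edge : ∀ {a b} → adj G a b ≡ false → ind (F a b) ≡ 0
    F-off-edge {a} {b} no-edge with F a b in aFb
    ... | false = refl
    ... | true  = ⊥-elim (subst T no-edge (F⊆G a b (subst T (sym aFb) tt)))

  weight-sum : ∀ u → sum (λ v → if adj G u v then weight u v else 0) ≡ t * r + w * (m + m)
  weight-sum u = begin
    sum (λ v → if adj G u v then weight u v else 0)
      ≡⟨ sum-cong-≗ masked ⟩
    sum (λ v → t * ind (adj G u v) + w * crossings u v)
      ≡⟨ ∑-distrib-+ (λ v → t * ind (adj G u v)) (λ v → w * crossings u v) ⟩
    sum (λ v → t * ind (adj G u v)) + sum (λ v → w * crossings u v)
      ≡⟨ cong₂ _+_ (*-distribˡ-sum t (ind ∘ adj G u)) (*-distribˡ-sum w (crossings u)) ⟨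
    t * degree G u + w * sum (crossings u)
      ≡⟨ cong₂ (λ x y → t * x + w * y) (G-regular u) (∑-distrib-+ (ind ∘ F u) (λ v → ind (F v u))) ⟩
    t * r + w * (count (F u) + count (λ v → F v u))
      ≡⟨ cong₂ (λ x y → t * r + w * (x + y)) (out-degree F-regular u) (in-degree F-regular u) ⟩
    t * r + w * (m + m)
      ∎
    where
    open ≡-Reasoning
    masked : ∀ v → (if adj G u v then weight u v else 0) ≡ t * ind (adj G u v) + w * crossings u v
    masked v with adj G u v in uv
    ... | true  = cong (_+ w * crossings u v) (sym (*-identityʳ t))
    ... | false = begin
      0                           ≡⟨ *-zeroʳ (t + w) ⟨
      (t + w) * 0                 ≡⟨ *-distribʳ-+ 0 t w ⟩
      t * 0 + w * 0               ≡⟨ cong (λ x → t * 0 + w * x) (crossings-off-edge uv) ⟨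
      t * 0 + w * crossings u v   ∎

  module _ (t+jw≢0 : ∀ j → j ≤ 2 → (t + w * j) % k ≢ 0) where

    labeling : EdgeLabeling k G
    labeling = record
      { label     = λ u v → weight u v mod k
      ; label-sym = λ u v _ → cong (λ j → (t + w * j) mod k) (+-comm (ind (F u v)) (ind (F v u)))
      ; nonzero   = λ u v _ →
          t+jw≢0 (crossings u v) (crossings≤2 u v) ∘ trans (sym (toℕ-fromℕ< (m%n<n (weight u v) k)))
      }

    labeling-magic : SumMagic k ((t * r + w * (m + m)) mod k) G
    labeling-magic = labeling , λ u → begin
      vertexSum labeling u % k                              ≡⟨ %-sum-cong k (λ v → residue (adj G u v) (weight u v)) ⟩
      sum (λ v → if adj G u v then weight u v else 0) % k   ≡⟨ cong (_% k) (weight-sum u) ⟩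
      (t * r + w * (m + m)) % k                             ≡⟨ toℕ-fromℕ< (m%n<n _ k) ⟨
      toℕ ((t * r + w * (m + m)) mod k)                     ∎
      where
      open ≡-Reasoning
      residue : ∀ b x → (if b then toℕ (x mod k) else 0) % k ≡ (if b then x else 0) % k
      residue true  x = trans (cong (_% k) (toℕ-fromℕ< (m%n<n x k))) (m%n%n≡m%n x k)
      residue false x = refl

residueWeights⇒sumMagic : ∀ {r k} .{{_ : NonZero k}} {c : Fin k} (G : SimpleGraph n) → Regular r G → r ≥ 3 →
                          ResidueWeights k r c → SumMagic k c G
residueWeights⇒sumMagic {k = k} G G-regular r≥3 W =
  let F , F⊆G , F-regular = regular-subrelation (≤-trans m≤3 r≥3) (adjacency-biregular G G-regular)
  in  subst (λ c → SumMagic k c G) sum≡c (labeling-magic G G-regular F F⊆G F-regular k t w t+jw≢0)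
  where open ResidueWeights W

mainTheorem4 : (n r k : ℕ) (G : SimpleGraph n) → Regular r G → r ≥ 3 → Odd r
    → (k≥5 : k ≥ 5) → CompletelyMagic k {{>-nonZero (≤-trans (s≤s z≤n) k≥5)}} G
mainTheorem4 n r k G G-regular r≥3 r-odd k≥5 c =
  residueWeights⇒sumMagic G G-regular r≥3 (toResidues (weights k≥5 r (toℕ c) r-odd))
  where
  instance
    k≢0 : NonZero k
    k≢0 = >-nonZero (≤-trans (s≤s z≤n) k≥5)
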